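{- Let $G$ be a finite digraph in which every edge is dominated, every vertex has out-degree $3$, and which contains exactly one $2$-cycle. Then $G$ has at least two distinct friendly partitions.
   Context: Digraphs have no loops and no parallel arcs in the same direction. A $2$-cycle is a pair of arcs $u\to v$, $v\to u$. An edge $u\to v$ is dominated if $u$ and $v$ have a common in-neighbor. A friendly partition of $G=(V,E)$ is an unordered partition $\{V_1,V_2\}$ of $V$ into two nonempty sets such that every vertex has at least one out-neighbor in its own part. -}

module Defs where

open import Data.Nat using (ℕ)
open import Data.Bool using (Bool; true; false; not; T)
open import Data.Fin using (Fin)
open import Data.Product using (Σ; ∃; _×_; _,_)
open import Data.Sum using (_⊎_)
open import Relation.Binary.PropositionalEquality using (_≡_)
open import Relation.Nullary using (¬_)
import Data.Vec.Functional as VF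
open import Data.Vec.Functional.Properties using ()
open import Data.Fin.Subset using (Subset; ∣_∣)
open import Data.Vec using (tabulate)

-- Simple: no loops (parallel arcs in the same direction are impossible
-- by construction of a relation).
record Digraph : Set where
  field
    n     : ℕ
    adj   : Fin n → Fin n → Bool
    loopless : ∀ v → adj v v ≡ false

open Digraph public

Arc : (G : Digraph) → Fin (n G) → Fin (n G) → Set
Arc G u v = T (adj G u v)

outDeg : (G : Digraph) → Fin (n G) → ℕ
outDeg G v = ∣ tabulate (adj G v) ∣

Dominated : (G : Digraph) → Fin (n G) → Fin (n G) → Set
Dominated G u v = ∃ λ w → Arc G w u × Arc G w v

EveryArcDominated : Digraph → Set
EveryArcDominated G = ∀ u v → Arc G u v → Dominated G u v

TwoCycle : (G : Digraph) → Fin (n G) → Fin (n G) → Set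
TwoCycle G u v = Arc G u v × Arc G v u

ExactlyOneTwoCycle : Digraph → Set
ExactlyOneTwoCycle G =
  Σ (Fin (n G)) λ u → Σ (Fin (n G)) λ v → TwoCycle G u v ×
    (∀ x y → TwoCycle G x y → (x ≡ u × y ≡ v) ⊎ (x ≡ v × y ≡ u))

-- A bipartition of the vertex set given by a colouring: V₁ = c⁻¹(true),
-- V₂ = c⁻¹(false).  The colourings c and (not ∘ c) describe the same
-- unordered partition {V₁, V₂}.
Colouring : Digraph → Set
Colouring G = Fin (n G) → Bool

Friendly : (G : Digraph) → Colouring G → Set
Friendly G c =
  (∃ λ v → c v ≡ true) × (∃ λ v → c v ≡ false) ×
  (∀ v → ∃ λ w → Arc G v w × c w ≡ c v)

SamePartition : (G : Digraph) → Colouring G → Colouring G → Set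
SamePartition G c c' = (∀ v → c v ≡ c' v) ⊎ (∀ v → c v ≡ not (c' v))

-- The 2-cycle {u, v} against the rest is one friendly partition: a vertex
-- off the cycle has at most two of its three arcs into the cycle.  For a
-- second one put u and v on the same side as some off-cycle in-neighbour
-- of the cycle.  If such an in-neighbour w is not an out-neighbour of any
-- common in-neighbour of u and v, the side {u, v, w} works, since every
-- other vertex misses one of u, v, w.  Otherwise the map sending w to such
-- a common in-neighbour is injective on the off-cycle in-neighbours, hence
-- onto, so they all point back into P = N⁻(u) ∪ N⁻(v).  Domination then
-- gives every vertex outside P an in-neighbour outside P, so P is avoided
-- by arbitrarily long walks, and the side of P is completed to a friendly
-- partition by the vertices from which no sufficiently long such walk starts.

module Submission where

open import Data.Bool using (Bool; true; false; not; T)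
open import Data.Bool.Properties using (T-≡)
open import Data.Empty using (⊥-elim)
open import Data.Fin using (Fin; zero; suc; punchOut)
open import Data.Fin.Properties using (_≟_; any?; punchOut-injective; injective⇒≤)
open import Data.Fin.Subset using (Subset; ∣_∣; ⁅_⁆; _∪_; _-_; _∈_)
open import Data.Fin.Subset.Properties
  using (_∈?_; p⊆q⇒∣p∣≤∣q∣; p⊂q⇒∣p∣<∣q∣; ∣⁅x⁆∣≡1; x∈⁅x⁆; x∈p∪q⁺; ∣p∣≤n;
         x∈p⇒∣p-x∣<∣p∣; x∈p∧x≢y⇒x∈p-y)
open import Data.Nat using (ℕ; zero; suc; _+_; _≤_; _<_; z≤n; s≤s)
open import Data.Nat.Properties
  using (≤-trans; ≤-reflexive; ≤-pred; ≤-<-trans; <-≤-trans; +-suc; +-monoʳ-≤;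
         n≤1+n; n≮0; 1+n≰n; <⇒≱; <-irrefl; module ≤-Reasoning)
open import Data.Product using (Σ; ∃; _×_; _,_; proj₁; proj₂)
open import Data.Sum using (_⊎_; inj₁; inj₂; [_,_])
open import Data.Vec using ([]; _∷_; tabulate)
open import Data.Vec.Properties using (lookup∘tabulate; lookup⇒[]=; []=⇒lookup)
open import Function using (_∘_)
open import Function.Bundles using (Equivalence)
open import Relation.Binary.PropositionalEquality
  using (_≡_; _≢_; refl; sym; trans; cong; cong₂; subst; ≢-sym)
open import Relation.Nullary using (¬_; Dec; yes; no; does; ¬?; _×-dec_; _⊎-dec_)
open import Relation.Nullary.Decidable
  using (T?; ⌊_⌋; toWitness; fromWitness; dec-true; dec-false; decidable-stable)

open import Defs

∈-tabulate⁺ : ∀ {m} {f : Fin m → Bool} {x} → T (f x) → x ∈ tabulate f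
∈-tabulate⁺ {f = f} {x} fx =
  lookup⇒[]= x (tabulate f) (trans (lookup∘tabulate f x) (Equivalence.to T-≡ fx))

∈-tabulate⁻ : ∀ {m} {f : Fin m → Bool} {x} → x ∈ tabulate f → T (f x)
∈-tabulate⁻ {f = f} {x} x∈ =
  Equivalence.from T-≡ (trans (sym (lookup∘tabulate f x)) ([]=⇒lookup x∈))

∣p∪q∣≤∣p∣+∣q∣ : ∀ {m} (p q : Subset m) → ∣ p ∪ q ∣ ≤ ∣ p ∣ + ∣ q ∣
∣p∪q∣≤∣p∣+∣q∣ []          []          = z≤n
∣p∪q∣≤∣p∣+∣q∣ (true ∷ p)  (true ∷ q)  = s≤s (≤-trans (∣p∪q∣≤∣p∣+∣q∣ p q) (+-monoʳ-≤ ∣ p ∣ (n≤1+n ∣ q ∣)))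
∣p∪q∣≤∣p∣+∣q∣ (true ∷ p)  (false ∷ q) = s≤s (∣p∪q∣≤∣p∣+∣q∣ p q)
∣p∪q∣≤∣p∣+∣q∣ (false ∷ p) (true ∷ q)  = ≤-trans (s≤s (∣p∪q∣≤∣p∣+∣q∣ p q)) (≤-reflexive (sym (+-suc ∣ p ∣ ∣ q ∣)))
∣p∪q∣≤∣p∣+∣q∣ (false ∷ p) (false ∷ q) = ∣p∪q∣≤∣p∣+∣q∣ p q

2<∣p∣⇒∃∉⁅a,b⁆ : ∀ {m} {p : Subset m} → 2 < ∣ p ∣ → ∀ a b → ∃ λ y → y ∈ p × y ≢ a × y ≢ b
2<∣p∣⇒∃∉⁅a,b⁆ {p = p} 2<∣p∣ a b with any? (λ y → y ∈? p ×-dec ¬? (y ≟ a) ×-dec ¬? (y ≟ b))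
... | yes found = found
... | no none = ⊥-elim (<⇒≱ 2<∣p∣ ∣p∣≤2)
  where
  open ≤-Reasoning
  p⊆⁅a⁆∪⁅b⁆ : ∀ {y} → y ∈ p → y ∈ ⁅ a ⁆ ∪ ⁅ b ⁆
  p⊆⁅a⁆∪⁅b⁆ {y} y∈p with y ≟ a | y ≟ b
  ... | yes refl | _        = x∈p∪q⁺ (inj₁ (x∈⁅x⁆ a))
  ... | no _     | yes refl = x∈p∪q⁺ (inj₂ (x∈⁅x⁆ b))
  ... | no y≢a   | no y≢b   = ⊥-elim (none (y , y∈p , y≢a , y≢b))
  ∣p∣≤2 : ∣ p ∣ ≤ 2
  ∣p∣≤2 = begin
    ∣ p ∣                 ≤⟨ p⊆q⇒∣p∣≤∣q∣ p⊆⁅a⁆∪⁅b⁆ ⟩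
    ∣ ⁅ a ⁆ ∪ ⁅ b ⁆ ∣     ≤⟨ ∣p∪q∣≤∣p∣+∣q∣ ⁅ a ⁆ ⁅ b ⁆ ⟩
    ∣ ⁅ a ⁆ ∣ + ∣ ⁅ b ⁆ ∣ ≡⟨ cong₂ _+_ (∣⁅x⁆∣≡1 a) (∣⁅x⁆∣≡1 b) ⟩
    2                     ∎

distinct₄⇒4≤∣p∣ : ∀ {m} {p : Subset m} {a b c d} → a ∈ p → b ∈ p → c ∈ p → d ∈ p →
                  a ≢ b → a ≢ c → a ≢ d → b ≢ c → b ≢ d → c ≢ d → 4 ≤ ∣ p ∣
distinct₄⇒4≤∣p∣ a∈p b∈p c∈p d∈p a≢b a≢c a≢d b≢c b≢d c≢d =
  ≤-<-trans (≤-<-trans (≤-<-trans (≤-<-trans z≤n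
    (x∈p⇒∣p-x∣<∣p∣ d∈p-a-b-c))
    (x∈p⇒∣p-x∣<∣p∣ c∈p-a-b))
    (x∈p⇒∣p-x∣<∣p∣ b∈p-a))
    (x∈p⇒∣p-x∣<∣p∣ a∈p)
  where
  b∈p-a     = x∈p∧x≢y⇒x∈p-y b∈p (≢-sym a≢b)
  c∈p-a-b   = x∈p∧x≢y⇒x∈p-y (x∈p∧x≢y⇒x∈p-y c∈p (≢-sym a≢c)) (≢-sym b≢c)
  d∈p-a-b-c = x∈p∧x≢y⇒x∈p-y (x∈p∧x≢y⇒x∈p-y (x∈p∧x≢y⇒x∈p-y d∈p (≢-sym a≢d)) (≢-sym b≢d)) (≢-sym c≢d)

Fin-injective⇒surjective : ∀ {m} {f : Fin m → Fin m} → (∀ {x y} → f x ≡ f y → x ≡ y) →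
                           ∀ y → ∃ λ x → f x ≡ y
Fin-injective⇒surjective {suc m} {f} f-inj y with any? (λ x → f x ≟ y)
... | yes hit = hit
... | no miss = ⊥-elim (1+n≰n (injective⇒≤ {f = g} g-inj))
  where
  g : Fin (suc m) → Fin m
  g x = punchOut {i = y} {j = f x} (λ y≡fx → miss (x , sym y≡fx))
  g-inj : ∀ {x x′} → g x ≡ g x′ → x ≡ x′
  g-inj {x} {x′} = f-inj ∘ punchOut-injective (λ e → miss (x , sym e)) (λ e → miss (x′ , sym e))

decreasing⇒stable : ∀ {m} {Q : ℕ → Fin m → Set} → (∀ k x → Dec (Q k x)) →
                    (∀ k x → Q (suc k) x → Q k x) → ∃ λ k → ∀ x → Q k x → Q (suc k) x
decreasing⇒stable {m} {Q} Q? shrink = descend m 0 (∣p∣≤n (S 0))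
  where
  S : ℕ → Subset m
  S k = tabulate (λ x → ⌊ Q? k x ⌋)
  strictly : ∀ {k x} → Q k x → ¬ Q (suc k) x → ∣ S (suc k) ∣ < ∣ S k ∣
  strictly {k} {x} q ¬q′ = p⊂q⇒∣p∣<∣q∣
    ( (λ {y} y∈ → ∈-tabulate⁺ (fromWitness (shrink k y (toWitness (∈-tabulate⁻ y∈)))))
    , x , ∈-tabulate⁺ (fromWitness q) , (λ x∈ → ¬q′ (toWitness (∈-tabulate⁻ x∈))) )
  descend : ∀ bound k → ∣ S k ∣ ≤ bound → ∃ λ k → ∀ x → Q k x → Q (suc k) x
  descend bound k ∣Sk∣≤bound with any? (λ x → Q? k x ×-dec ¬? (Q? (suc k) x))
  ... | no none = k , λ x q → decidable-stable (Q? (suc k) x) (λ ¬q′ → none (x , q , ¬q′))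
  descend zero k ∣Sk∣≤0 | yes (x , q , ¬q′) = ⊥-elim (n≮0 (<-≤-trans (strictly q ¬q′) ∣Sk∣≤0))
  descend (suc bound) k ∣Sk∣≤bound | yes (x , q , ¬q′) =
    descend bound (suc k) (≤-pred (<-≤-trans (strictly q ¬q′) ∣Sk∣≤bound))

Arc⇒≢ : (G : Digraph) {x y : Fin (n G)} → Arc G x y → x ≢ y
Arc⇒≢ G {x} xy refl = subst T (loopless G x) xy

¬Arc⇒≢ : (G : Digraph) {x a y : Fin (n G)} → ¬ Arc G x a → Arc G x y → y ≢ a
¬Arc⇒≢ G ¬xa xy refl = ¬xa xy

Closed : (G : Digraph) → (Fin (n G) → Set) → Set
Closed G Q = ∀ x → Q x → ∃ λ y → Arc G x y × Q y

friendly-colouring : (G : Digraph) {Q : Fin (n G) → Set} (Q? : ∀ x → Dec (Q x)) →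
                     ∃ Q → ∃ (λ x → ¬ Q x) → Closed G Q → Closed G (λ x → ¬ Q x) →
                     Friendly G (λ x → does (Q? x))
friendly-colouring G {Q} Q? (p , qp) (r , ¬qr) closed closedᶜ =
  (p , dec-true (Q? p) qp) , (r , dec-false (Q? r) ¬qr) , same-side
  where
  same-side : ∀ x → ∃ λ y → Arc G x y × does (Q? y) ≡ does (Q? x)
  same-side x with Q? x
  ... | yes qx = let (y , xy , qy) = closed x qx in y , xy , dec-true (Q? y) qy
  ... | no ¬qx = let (y , xy , ¬qy) = closedᶜ x ¬qx in y , xy , dec-false (Q? y) ¬qy

module AvoidingWalks (G : Digraph) {P : Fin (n G) → Set} (P? : ∀ x → Dec (P x)) where

  AvoidingWalk : ℕ → Fin (n G) → Set
  AvoidingWalk zero    x = ¬ P x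
  AvoidingWalk (suc k) x = ¬ P x × ∃ λ y → Arc G x y × AvoidingWalk k y

  avoidingWalk? : ∀ k x → Dec (AvoidingWalk k x)
  avoidingWalk? zero    x = ¬? (P? x)
  avoidingWalk? (suc k) x = ¬? (P? x) ×-dec any? (λ y → T? (adj G x y) ×-dec avoidingWalk? k y)

  AvoidingWalk⇒¬P : ∀ k {x} → AvoidingWalk k x → ¬ P x
  AvoidingWalk⇒¬P zero    ¬px       = ¬px
  AvoidingWalk⇒¬P (suc k) (¬px , _) = ¬px

  shorten : ∀ k x → AvoidingWalk (suc k) x → AvoidingWalk k x
  shorten zero    x (¬px , _)               = ¬px
  shorten (suc k) x (¬px , y , xy , walk) = ¬px , y , xy , shorten k y walk

  avoiding-walks-unbounded : ∃ (λ x → ¬ P x) → (∀ x → ¬ P x → ∃ λ s → Arc G s x × ¬ P s) →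
                             ∀ k → ∃ (AvoidingWalk k)
  avoiding-walks-unbounded start back zero = start
  avoiding-walks-unbounded start back (suc k) with avoiding-walks-unbounded start back k
  ... | x , walk with back x (AvoidingWalk⇒¬P k walk)
  ... | s , sx , ¬ps = s , ¬ps , x , sx , walk

  -- Take k such that avoiding walks of length k extend to length k + 1;
  -- then both the starts of such walks and the other vertices form closed sides.
  friendly-extension : (∀ x → ∃ (Arc G x)) → ∃ P → Closed G P → (∀ k → ∃ (AvoidingWalk k)) →
                       Σ (Colouring G) λ c → Friendly G c × (∀ x → P x → c x ≡ true)
  friendly-extension out (p , pp) closed walks =
    c , friendly-colouring G stuck? (p , λ walk → AvoidingWalk⇒¬P k walk pp)
                           (proj₁ (walks k) , λ ¬walk → ¬walk (proj₂ (walks k))) closedStuck closedᶜ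
      , λ x px → dec-true (stuck? x) (λ walk → AvoidingWalk⇒¬P k walk px)
    where
    stable : ∃ λ k → ∀ x → AvoidingWalk k x → AvoidingWalk (suc k) x
    stable = decreasing⇒stable avoidingWalk? shorten
    k : ℕ
    k = proj₁ stable
    Stuck : Fin (n G) → Set
    Stuck x = ¬ AvoidingWalk k x
    stuck? : ∀ x → Dec (Stuck x)
    stuck? x = ¬? (avoidingWalk? k x)
    c : Colouring G
    c x = does (stuck? x)
    closedStuck : Closed G Stuck
    closedStuck x stuck with P? x
    ... | yes px = let (y , xy , py) = closed x px in y , xy , λ walk → AvoidingWalk⇒¬P k walk py
    ... | no ¬px = let (y , xy) = out x in y , xy , λ walk → stuck (shorten k x (¬px , y , xy , walk))
    closedᶜ : Closed G (λ x → ¬ Stuck x)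
    closedᶜ x ¬stuck with proj₂ stable x (decidable-stable (avoidingWalk? k x) ¬stuck)
    ... | _ , y , xy , walk = y , xy , λ stuck → stuck walk

module OutDegreeThree (G : Digraph) (deg : ∀ x → outDeg G x ≡ 3) where

  out-avoiding₂ : ∀ x a b → ∃ λ y → Arc G x y × y ≢ a × y ≢ b
  out-avoiding₂ x a b with 2<∣p∣⇒∃∉⁅a,b⁆ (≤-reflexive (sym (deg x))) a b
  ... | y , y∈ , y≢a , y≢b = y , ∈-tabulate⁻ y∈ , y≢a , y≢b

  out-neighbour : ∀ x → ∃ (Arc G x)
  out-neighbour x = let (y , xy , _) = out-avoiding₂ x x x in y , xy

  out-avoiding₃ : ∀ x a b c → ¬ (Arc G x a × Arc G x b × Arc G x c) →
                  ∃ λ y → Arc G x y × y ≢ a × y ≢ b × y ≢ c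
  out-avoiding₃ x a b c ¬all with T? (adj G x a) | T? (adj G x b) | T? (adj G x c)
  ... | no ¬xa | _ | _ = let (y , xy , y≢b , y≢c) = out-avoiding₂ x b c in
                         y , xy , ¬Arc⇒≢ G ¬xa xy , y≢b , y≢c
  ... | yes _ | no ¬xb | _ = let (y , xy , y≢a , y≢c) = out-avoiding₂ x a c in
                             y , xy , y≢a , ¬Arc⇒≢ G ¬xb xy , y≢c
  ... | yes _ | yes _ | no ¬xc = let (y , xy , y≢a , y≢b) = out-avoiding₂ x a b in
                                 y , xy , y≢a , y≢b , ¬Arc⇒≢ G ¬xc xy
  ... | yes xa | yes xb | yes xc = ⊥-elim (¬all (xa , xb , xc))

  out-exactly₃ : ∀ {x a b c y} → Arc G x a → Arc G x b → Arc G x c → a ≢ b → a ≢ c → b ≢ c →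
                 Arc G x y → y ≡ a ⊎ y ≡ b ⊎ y ≡ c
  out-exactly₃ {x} {a} {b} {c} {y} xa xb xc a≢b a≢c b≢c xy with y ≟ a | y ≟ b | y ≟ c
  ... | yes y≡a | _       | _       = inj₁ y≡a
  ... | no _    | yes y≡b | _       = inj₂ (inj₁ y≡b)
  ... | no _    | no _    | yes y≡c = inj₂ (inj₂ y≡c)
  ... | no y≢a  | no y≢b  | no y≢c  = ⊥-elim (<-irrefl refl (subst (3 <_) (deg x) 4≤deg))
    where
    4≤deg : 4 ≤ outDeg G x
    4≤deg = distinct₄⇒4≤∣p∣ (∈-tabulate⁺ xa) (∈-tabulate⁺ xb) (∈-tabulate⁺ xc) (∈-tabulate⁺ xy)
                            a≢b a≢c (≢-sym y≢a) b≢c (≢-sym y≢b) (≢-sym y≢c)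

module UniqueTwoCycle (G : Digraph) (dom : EveryArcDominated G) (deg : ∀ x → outDeg G x ≡ 3)
                      {u v : Fin (n G)} (uv : Arc G u v) (vu : Arc G v u)
                      (unique : ∀ x y → TwoCycle G x y → (x ≡ u × y ≡ v) ⊎ (x ≡ v × y ≡ u)) where

  open OutDegreeThree G deg

  OnCycle : Fin (n G) → Set
  OnCycle x = x ≡ u ⊎ x ≡ v

  onCycle? : ∀ x → Dec (OnCycle x)
  onCycle? x = x ≟ u ⊎-dec x ≟ v

  ¬OnCycle : ∀ {x} → x ≢ u → x ≢ v → ¬ OnCycle x
  ¬OnCycle x≢u x≢v = [ x≢u , x≢v ]

  cycleColouring : Colouring G
  cycleColouring x = does (onCycle? x)

  cycle-friendly : Friendly G cycleColouring
  cycle-friendly = friendly-colouring G onCycle? (u , inj₁ refl) outside closed closedᶜ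
    where
    outside : ∃ λ x → ¬ OnCycle x
    outside = let (y , _ , y≢u , y≢v) = out-avoiding₂ u u v in y , ¬OnCycle y≢u y≢v
    closed : Closed G OnCycle
    closed x (inj₁ refl) = v , uv , inj₂ refl
    closed x (inj₂ refl) = u , vu , inj₁ refl
    closedᶜ : Closed G (λ x → ¬ OnCycle x)
    closedᶜ x _ = let (y , xy , y≢u , y≢v) = out-avoiding₂ x u v in y , xy , ¬OnCycle y≢u y≢v

  differs-from-cycle : (c : Colouring G) {w : Fin (n G)} → ¬ OnCycle w → c u ≡ true → c w ≡ true →
                       ¬ SamePartition G cycleColouring c
  differs-from-cycle c {w} off cu cw (inj₁ same)
    with () ← trans (sym (dec-false (onCycle? w) off)) (trans (same w) cw)
  differs-from-cycle c {w} off cu cw (inj₂ flipped)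
    with () ← trans (sym (dec-true (onCycle? u) (inj₁ refl))) (trans (flipped u) (cong not cu))

  InNeighbour : Fin (n G) → Set
  InNeighbour x = Arc G x u ⊎ Arc G x v

  inNeighbour? : ∀ x → Dec (InNeighbour x)
  inNeighbour? x = T? (adj G x u) ⊎-dec T? (adj G x v)

  into-cycle : ∀ {x} → InNeighbour x → ∃ λ y → Arc G x y × OnCycle y
  into-cycle (inj₁ xu) = u , xu , inj₁ refl
  into-cycle (inj₂ xv) = v , xv , inj₂ refl

  arc-to-cycle : ∀ {x y} → Arc G x y → OnCycle y → InNeighbour x
  arc-to-cycle xy (inj₁ refl) = inj₁ xy
  arc-to-cycle xy (inj₂ refl) = inj₂ xy

  OnCycle⇒InNeighbour : ∀ {x} → OnCycle x → InNeighbour x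
  OnCycle⇒InNeighbour (inj₁ refl) = inj₂ uv
  OnCycle⇒InNeighbour (inj₂ refl) = inj₁ vu

  OuterInNeighbour : Fin (n G) → Set
  OuterInNeighbour x = InNeighbour x × ¬ OnCycle x

  outerInNeighbour? : ∀ x → Dec (OuterInNeighbour x)
  outerInNeighbour? x = inNeighbour? x ×-dec ¬? (onCycle? x)

  CycleDominator : Fin (n G) → Set
  CycleDominator x = Arc G x u × Arc G x v

  ReachedByCycleDominator : Fin (n G) → Set
  ReachedByCycleDominator w = ∃ λ x → CycleDominator x × Arc G x w

  reached? : ∀ w → Dec (ReachedByCycleDominator w)
  reached? w = any? (λ x → (T? (adj G x u) ×-dec T? (adj G x v)) ×-dec T? (adj G x w))

  CycleDominator⇒Outer : ∀ {x} → CycleDominator x → OuterInNeighbour x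
  CycleDominator⇒Outer (xu , xv) = inj₁ xu , ¬OnCycle (Arc⇒≢ G xu) (Arc⇒≢ G xv)

  cycleDominator-out : ∀ {x w y} → CycleDominator x → Arc G x w → ¬ OnCycle w → Arc G x y →
                       OnCycle y ⊎ y ≡ w
  cycleDominator-out (xu , xv) xw off xy
    with out-exactly₃ xu xv xw (Arc⇒≢ G uv) (λ u≡w → off (inj₁ (sym u≡w))) (λ v≡w → off (inj₂ (sym v≡w))) xy
  ... | inj₁ y≡u        = inj₁ (inj₁ y≡u)
  ... | inj₂ (inj₁ y≡v) = inj₁ (inj₂ y≡v)
  ... | inj₂ (inj₂ y≡w) = inj₂ y≡w

  friendly-from-unreached : ∀ w → OuterInNeighbour w → ¬ ReachedByCycleDominator w →
                            ∃ λ c → Friendly G c × ¬ SamePartition G cycleColouring c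
  friendly-from-unreached w (in-w , off-w) unreached =
    does ∘ Q? , friendly-colouring G Q? (u , inj₁ (inj₁ refl)) outside closed closedᶜ
              , differs-from-cycle (does ∘ Q?) off-w (dec-true (Q? u) (inj₁ (inj₁ refl)))
                                                    (dec-true (Q? w) (inj₂ refl))
    where
    Q : Fin (n G) → Set
    Q x = OnCycle x ⊎ x ≡ w
    Q? : ∀ x → Dec (Q x)
    Q? x = onCycle? x ⊎-dec x ≟ w
    outside : ∃ λ x → ¬ Q x
    outside = let (y , wy , y≢u , y≢v) = out-avoiding₂ w u v in
              y , [ ¬OnCycle y≢u y≢v , ≢-sym (Arc⇒≢ G wy) ]
    closed : Closed G Q
    closed x (inj₁ (inj₁ refl)) = v , uv , inj₁ (inj₂ refl)
    closed x (inj₁ (inj₂ refl)) = u , vu , inj₁ (inj₁ refl)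
    closed x (inj₂ refl) = let (y , wy , on-y) = into-cycle in-w in y , wy , inj₁ on-y
    closedᶜ : Closed G (λ x → ¬ Q x)
    closedᶜ x _ with out-avoiding₃ x u v w (λ (xu , xv , xw) → unreached (x , (xu , xv) , xw))
    ... | y , xy , y≢u , y≢v , y≢w = y , xy , [ ¬OnCycle y≢u y≢v , y≢w ]

  module AllReached (reached : ∀ w → OuterInNeighbour w → ReachedByCycleDominator w) where

    dominator : Fin (n G) → Fin (n G)
    dominator w with outerInNeighbour? w
    ... | yes outer = proj₁ (reached w outer)
    ... | no _      = w

    dominator-spec : ∀ w → (OuterInNeighbour w × CycleDominator (dominator w) × Arc G (dominator w) w)
                         ⊎ (¬ OuterInNeighbour w × dominator w ≡ w)
    dominator-spec w with outerInNeighbour? w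
    ... | yes outer = inj₁ (outer , proj₂ (reached w outer))
    ... | no ¬outer = inj₂ (¬outer , refl)

    dominator-injective : ∀ {w w′} → dominator w ≡ dominator w′ → w ≡ w′
    dominator-injective {w} {w′} eq with dominator-spec w | dominator-spec w′
    ... | inj₁ (outer , d , dw) | inj₁ (outer′ , _ , dw′)
      with cycleDominator-out d dw (proj₂ outer) (subst (λ x → Arc G x w′) (sym eq) dw′)
    ...   | inj₁ on-w′ = ⊥-elim (proj₂ outer′ on-w′)
    ...   | inj₂ w′≡w  = sym w′≡w
    dominator-injective {w} {w′} eq | inj₁ (_ , d , _) | inj₂ (¬outer′ , d′≡w′) =
      ⊥-elim (¬outer′ (subst OuterInNeighbour (trans eq d′≡w′) (CycleDominator⇒Outer d)))
    dominator-injective {w} {w′} eq | inj₂ (¬outer , d≡w) | inj₁ (_ , d′ , _) =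
      ⊥-elim (¬outer (subst OuterInNeighbour (trans (sym eq) d≡w) (CycleDominator⇒Outer d′)))
    dominator-injective {w} {w′} eq | inj₂ (_ , d≡w) | inj₂ (_ , d′≡w′) = trans (sym d≡w) (trans eq d′≡w′)

    -- Every outer in-neighbour is a dominator: dominator maps the outer
    -- in-neighbours injectively into themselves, so it is onto them.
    outer⇒dominator : ∀ {x} → OuterInNeighbour x →
                      CycleDominator x × ∃ λ w → OuterInNeighbour w × Arc G x w
    outer⇒dominator {x} outer-x with Fin-injective⇒surjective dominator-injective x
    ... | w , dw≡x with dominator-spec w
    ...   | inj₁ (outer-w , d , dw) = subst CycleDominator dw≡x d , w , outer-w , subst (λ z → Arc G z w) dw≡x dw
    ...   | inj₂ (¬outer-w , dw≡w) = ⊥-elim (¬outer-w (subst OuterInNeighbour (trans (sym dw≡x) dw≡w) outer-x))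

    outer-out : ∀ {x y} → OuterInNeighbour x → Arc G x y → InNeighbour y
    outer-out outer-x xy with outer⇒dominator outer-x
    ... | d , w , outer-w , xw with cycleDominator-out d xw (proj₂ outer-w) xy
    ...   | inj₁ on-y = OnCycle⇒InNeighbour on-y
    ...   | inj₂ refl = proj₁ outer-w

    second-cycle⇒≡v : ∀ {a} → Arc G u a → Arc G a u → a ≡ v
    second-cycle⇒≡v ua au with unique u _ (ua , au)
    ... | inj₁ (_ , a≡v)  = a≡v
    ... | inj₂ (u≡v , _) = ⊥-elim (Arc⇒≢ G uv u≡v)

    u-out-outside : ∀ {a} → Arc G u a → a ≢ v → ¬ InNeighbour a
    u-out-outside ua a≢v in-a =
      a≢v (second-cycle⇒≡v ua (proj₁ (proj₁ (outer⇒dominator (in-a , ¬OnCycle (≢-sym (Arc⇒≢ G ua)) a≢v)))))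

    v-out-shared : ∀ {a} → Arc G u a → a ≢ v → Arc G v a
    v-out-shared {a} ua a≢v with dom u a ua
    ... | s , su , sa with s ≟ v
    ...   | yes refl = sa
    ...   | no s≢v   = ⊥-elim (u-out-outside ua a≢v (outer-out (inj₁ su , ¬OnCycle (Arc⇒≢ G su) s≢v) sa))

    cycle-out : ∀ {a b s t} → Arc G u a → Arc G u b → a ≢ v → b ≢ v → a ≢ b →
                OnCycle s → Arc G s t → OnCycle t ⊎ t ≡ a ⊎ t ≡ b
    cycle-out ua ub a≢v b≢v a≢b (inj₁ refl) ut
      with out-exactly₃ uv ua ub (≢-sym a≢v) (≢-sym b≢v) a≢b ut
    ... | inj₁ t≡v = inj₁ (inj₂ t≡v)
    ... | inj₂ t∈ab = inj₂ t∈ab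
    cycle-out ua ub a≢v b≢v a≢b (inj₂ refl) vt
      with out-exactly₃ vu (v-out-shared ua a≢v) (v-out-shared ub b≢v) (Arc⇒≢ G ua) (Arc⇒≢ G ub) a≢b vt
    ... | inj₁ t≡u = inj₁ (inj₁ t≡u)
    ... | inj₂ t∈ab = inj₂ t∈ab

    outside-in-neighbour : ∀ r → ¬ InNeighbour r → ∃ λ s → Arc G s r × ¬ InNeighbour s
    outside-in-neighbour r ¬in-r with out-avoiding₂ u v v
    ... | a , ua , a≢v , _ with out-avoiding₂ u v a
    ... | b , ub , b≢v , b≢a with out-avoiding₂ r a b
    ... | t , rt , t≢a , t≢b with dom r t rt
    ... | s , sr , st = s , sr , ¬in-s
      where
      ¬in-s : ¬ InNeighbour s
      ¬in-s in-s with onCycle? s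
      ... | no off = ¬in-r (outer-out (in-s , off) sr)
      ... | yes on with cycle-out ua ub a≢v b≢v (≢-sym b≢a) on st
      ...   | inj₁ on-t       = ¬in-r (arc-to-cycle rt on-t)
      ...   | inj₂ (inj₁ t≡a) = t≢a t≡a
      ...   | inj₂ (inj₂ t≡b) = t≢b t≡b

    InNeighbour-closed : Closed G InNeighbour
    InNeighbour-closed x in-x = let (y , xy , on-y) = into-cycle in-x in y , xy , OnCycle⇒InNeighbour on-y

    outside-cycle-neighbourhood : ∃ λ x → ¬ InNeighbour x
    outside-cycle-neighbourhood = let (a , ua , a≢v , _) = out-avoiding₂ u v v in a , u-out-outside ua a≢v

    open AvoidingWalks G inNeighbour? using (friendly-extension; avoiding-walks-unbounded)

    friendly-from-reached : ∃ λ c → Friendly G c × ¬ SamePartition G cycleColouring c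
    friendly-from-reached =
      let (w , wu , wv) = dom u v uv
          (c , friendly , in⇒true) = friendly-extension out-neighbour (u , inj₂ uv) InNeighbour-closed
                                       (avoiding-walks-unbounded outside-cycle-neighbourhood outside-in-neighbour)
      in c , friendly , differs-from-cycle c (¬OnCycle (Arc⇒≢ G wu) (Arc⇒≢ G wv))
                                             (in⇒true u (inj₂ uv)) (in⇒true w (inj₁ wu))

  second-friendly-colouring : ∃ λ c → Friendly G c × ¬ SamePartition G cycleColouring c
  second-friendly-colouring with any? (λ w → outerInNeighbour? w ×-dec ¬? (reached? w))
  ... | yes (w , outer , unreached) = friendly-from-unreached w outer unreached
  ... | no none = AllReached.friendly-from-reached
                    (λ w outer → decidable-stable (reached? w) (λ unreached → none (w , outer , unreached)))

lemma3p5 : (G : Digraph) → EveryArcDominated G →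
           (∀ v → outDeg G v ≡ 3) → ExactlyOneTwoCycle G →
           Σ (Colouring G) λ c₁ → Σ (Colouring G) λ c₂ →
             Friendly G c₁ × Friendly G c₂ × ¬ SamePartition G c₁ c₂
lemma3p5 G dom deg (u , v , (uv , vu) , unique) =
  let (c , friendly , differs) = second-friendly-colouring
  in cycleColouring , c , cycle-friendly , friendly , differs
  where open UniqueTwoCycle G dom deg uv vu unique
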